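{- Let $\alpha\in\{0,1\}$. For every integer $\ell\geq 1$ and every $h\in\{1,2,\dots, M_{\mathbf{c}}(\ell)\}$, there is a factor $W_{h}$ of $\mathbf c$ of length $\ell+3$ such that $|W_{h}|_{1}=h$ and $W_h=00U_{h}\alpha$ for some factor $U_h$ of $\mathbf c$ of length $\ell$.
   Context: The Cantor sequence $\mathbf{c}=c_0c_1c_2\cdots\in\{0,1\}^{\mathbb N}$ is defined by $c_0=1$ and $c_{3n}=c_{3n+2}=c_n$, $c_{3n+1}=0$ for all $n\geq 0$. A factor of $\mathbf c$ is a finite word $c_i\cdots c_{i+m-1}$. $|W|_1$ is the number of letters $1$ in $W$. For $n\ge1$, $M_{\mathbf c}(n)=\max\{\sum_{j=i}^{i+n-1}c_j\mid i\geq0\}$. -}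

module Defs where

open import Data.Nat using (ℕ; zero; suc; _+_; _*_; _≤_)
open import Data.Nat.DivMod using (_/_; _%_)
open import Data.List using (List; []; _∷_; map; upTo; length; filter)
open import Data.Nat using (_≟_)
open import Data.Product using (Σ; _×_; ∃-syntax)
open import Relation.Binary.PropositionalEquality using (_≡_)

-- Cantor sequence with fuel: c₀ = 1, c_{3n} = c_{3n+2} = c_n, c_{3n+1} = 0.
-- Fuel n suffices since n / 3 < n for n ≥ 1.
cantorF : ℕ → ℕ → ℕ
cantorF _        zero    = 1
cantorF zero     (suc n) = 0   -- unreachable with enough fuel
cantorF (suc f) (suc n) with suc n % 3
... | 1 = 0
... | _ = cantorF f (suc n / 3)

cantor : ℕ → ℕ
cantor n = cantorF n n

factor : ℕ → ℕ → List ℕ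
factor i m = map (λ k → cantor (i + k)) (upTo m)

IsFactor : List ℕ → Set
IsFactor W = ∃[ i ] factor i (length W) ≡ W

count1 : List ℕ → ℕ
count1 W = length (filter (_≟ 1) W)

IsMc : ℕ → ℕ → Set
IsMc n M = (∃[ i ] count1 (factor i n) ≡ M) × (∀ i → count1 (factor i n) ≤ M)

module Submission where

-- Write c for the Cantor sequence, S n = |c₀ ⋯ c_{n-1}|₁ for its prefix
-- counts, and T = 3^K.
--
-- The proof rests on the self-similarity of c: on [0, 3T) the sequence
-- reads  c₀⋯c_{T-1} · 0^T · c₀⋯c_{T-1}.  From it we get
--   (1) S is subadditive, S (a + b) ≤ S a + S b (induction on K, using
--       S x = S T on [T, 2T] and S (2T + y) = S T + S y), so no window of
--       length ℓ contains more ones than the prefix:  M_c(ℓ) ≤ S ℓ;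
--   (2) a window starting inside the zero block and ending inside the
--       second copy reads 0^z c₀⋯c_{y-1}.
-- Since S grows in unit steps and c has no factor 11, every 1 ≤ h ≤ S ℓ
-- is S m + α for some m ≤ ℓ with c_m = α.  Then, for T > ℓ + 2 and
-- j = ℓ - m, the window 0^{j+2} c₀⋯c_m of (2) is the required
-- W_h = 0 0 U_h α with U_h = 0^j c₀⋯c_{m-1}.

open import Defs
open import Data.Nat using (ℕ; _+_; _≤_)
open import Data.List using (List; _∷_; []; _++_; length)
open import Data.Product using (Σ; _×_; ∃-syntax)
open import Data.Sum using (_⊎_)
open import Relation.Binary.PropositionalEquality using (_≡_)

open import Data.Nat using (zero; suc; _*_; _∸_; _^_; _<_; _≤?_; _≟_; z≤n; s≤s)
open import Data.Nat.Properties
open import Data.Nat.DivMod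
open import Data.Nat.Divisibility using (divides-refl)
open import Data.Nat.Induction using (<-rec)
open import Data.Nat.Tactic.RingSolver using (solve-∀)
open import Data.List using (map; filter; replicate; upTo; applyUpTo)
open import Data.List.Properties
  using (map-applyUpTo; map-cong; length-map; length-applyUpTo; length-++; filter-++; ++-assoc)
open import Data.Product using (_,_)
open import Data.Sum using (inj₁; inj₂)
open import Data.Empty using (⊥-elim)
open import Function using (id; _∘_)
open import Relation.Nullary using (Dec; yes; no)
open import Relation.Binary.PropositionalEquality
  using (refl; sym; trans; cong; cong₂; subst; subst₂; module ≡-Reasoning)

-- c_{3q+r} = digitRule r (c_q): the middle third is erased.
digitRule : ℕ → ℕ → ℕ
digitRule 1 _ = 0
digitRule _ x = x

third-≤ : ∀ n → suc n / 3 ≤ n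
third-≤ n = ≤-pred (m/n<m (suc n) 3 (s≤s (s≤s z≤n)))

cantorF-step : ∀ f n → cantorF (suc f) (suc n) ≡ digitRule (suc n % 3) (cantorF f (suc n / 3))
cantorF-step f n with suc n % 3
... | 0           = refl
... | 1           = refl
... | suc (suc _) = refl

cantorF-fuel : ∀ f g n → n ≤ f → n ≤ g → cantorF f n ≡ cantorF g n
cantorF-fuel f       g       zero    _         _         = refl
cantorF-fuel (suc f) (suc g) (suc n) (s≤s n≤f) (s≤s n≤g) = begin
  cantorF (suc f) (suc n)                        ≡⟨ cantorF-step f n ⟩
  digitRule (suc n % 3) (cantorF f (suc n / 3))  ≡⟨ cong (digitRule (suc n % 3)) (cantorF-fuel f g _ (≤-trans (third-≤ n) n≤f) (≤-trans (third-≤ n) n≤g)) ⟩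
  digitRule (suc n % 3) (cantorF g (suc n / 3))  ≡⟨ sym (cantorF-step g n) ⟩
  cantorF (suc g) (suc n)                        ∎
  where open ≡-Reasoning

cantor-rec : ∀ n → cantor n ≡ digitRule (n % 3) (cantor (n / 3))
cantor-rec zero    = refl
cantor-rec (suc n) = trans (cantorF-step n n)
  (cong (digitRule (suc n % 3)) (cantorF-fuel n (suc n / 3) (suc n / 3) (third-≤ n) ≤-refl))

cantor-digit : ∀ q r → r < 3 → cantor (r + q * 3) ≡ digitRule r (cantor q)
cantor-digit q r r<3 = begin
  cantor (r + q * 3)                                     ≡⟨ cantor-rec (r + q * 3) ⟩
  digitRule ((r + q * 3) % 3) (cantor ((r + q * 3) / 3)) ≡⟨ cong₂ (λ s t → digitRule s (cantor t)) remainder quotient ⟩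
  digitRule r (cantor q)                                 ∎
  where
  open ≡-Reasoning
  remainder : (r + q * 3) % 3 ≡ r
  remainder = trans ([m+kn]%n≡m%n r q 3) (m<n⇒m%n≡m r<3)
  quotient : (r + q * 3) / 3 ≡ q
  quotient = trans (+-distrib-/-∣ʳ r (divides-refl q)) (cong₂ _+_ (m<n⇒m/n≡0 r<3) (m*n/n≡m q 3))

data Ternary : ℕ → Set where
  ternary : ∀ q r → r < 3 → Ternary (r + q * 3)

ternary-view : ∀ n → Ternary n
ternary-view n = subst Ternary (sym (m≡m%n+[m/n]*n n 3)) (ternary (n / 3) (n % 3) (m%n<n n 3))

IsBit : ℕ → Set
IsBit x = x ≡ 0 ⊎ x ≡ 1

digitRule-bit : ∀ r {x} → IsBit x → IsBit (digitRule r x)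
digitRule-bit 0             b = b
digitRule-bit 1             _ = inj₁ refl
digitRule-bit (suc (suc _)) b = b

cantor-bit : ∀ n → IsBit (cantor n)
cantor-bit n = bitF n n
  where
  bitF : ∀ f n → IsBit (cantorF f n)
  bitF _       zero    = inj₂ refl
  bitF zero    (suc n) = inj₁ refl
  bitF (suc f) (suc n) = subst IsBit (sym (cantorF-step f n)) (digitRule-bit (suc n % 3) (bitF f (suc n / 3)))

-- c has no factor 11: a 1 at 3q+2 comes from a 1 at q, and then
-- c_{3q+3} = c_{q+1} = 0 by induction.
no-11 : ∀ n → cantor n ≡ 1 → cantor (suc n) ≡ 0
no-11 = <-rec (λ n → cantor n ≡ 1 → cantor (suc n) ≡ 0) step
  where
  step : ∀ n → (∀ {k} → k < n → cantor k ≡ 1 → cantor (suc k) ≡ 0) → cantor n ≡ 1 → cantor (suc n) ≡ 0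
  step n rec cn≡1 with ternary-view n
  ... | ternary q 0 _ = cantor-digit q 1 (s≤s (s≤s z≤n))
  ... | ternary q 1 _ with () ← trans (sym (cantor-digit q 1 (s≤s (s≤s z≤n)))) cn≡1
  ... | ternary q 2 _ = trans (cantor-digit (suc q) 0 (s≤s z≤n))
                          (rec (s≤s (m≤n⇒m≤1+n (m≤m*n q 3))) (trans (sym (cantor-digit q 2 ≤-refl)) cn≡1))
  ... | ternary q (suc (suc (suc _))) (s≤s (s≤s (s≤s ())))

-- Zeros are mapped to zeros, so a zero block reproduces itself at scale 3.
digitRule-zero : ∀ r → digitRule r 0 ≡ 0
digitRule-zero 0             = refl
digitRule-zero 1             = refl
digitRule-zero (suc (suc _)) = refl

quotient-< : ∀ {q r T} → r + q * 3 < 3 * T → q < T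
quotient-< {q} {r} {T} lt = *-cancelˡ-< 3 q T (≤-<-trans (≤-trans (≤-reflexive (*-comm 3 q)) (m≤n+m (q * 3) r)) lt)

middle-zero : ∀ K n → n < 3 ^ K → cantor (3 ^ K + n) ≡ 0
middle-zero zero    zero    _ = refl
middle-zero zero    (suc _) (s≤s ())
middle-zero (suc K) n       n<3T with ternary-view n
... | ternary q r r<3 = begin
  cantor (3 * T + (r + q * 3))    ≡⟨ cong cantor (regroup r q T) ⟩
  cantor (r + (T + q) * 3)        ≡⟨ cantor-digit (T + q) r r<3 ⟩
  digitRule r (cantor (T + q))    ≡⟨ cong (digitRule r) (middle-zero K q (quotient-< n<3T)) ⟩
  digitRule r 0                   ≡⟨ digitRule-zero r ⟩
  0                               ∎
  where
  open ≡-Reasoning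
  T = 3 ^ K
  regroup : ∀ r q T → 3 * T + (r + q * 3) ≡ r + (T + q) * 3
  regroup = solve-∀

last-copy : ∀ K n → n < 3 ^ K → cantor (3 ^ K + 3 ^ K + n) ≡ cantor n
last-copy zero    zero    _ = refl
last-copy zero    (suc _) (s≤s ())
last-copy (suc K) n       n<3T with ternary-view n
... | ternary q r r<3 = begin
  cantor (3 * T + 3 * T + (r + q * 3)) ≡⟨ cong cantor (regroup r q T) ⟩
  cantor (r + (T + T + q) * 3)         ≡⟨ cantor-digit (T + T + q) r r<3 ⟩
  digitRule r (cantor (T + T + q))     ≡⟨ cong (digitRule r) (last-copy K q (quotient-< n<3T)) ⟩
  digitRule r (cantor q)               ≡⟨ sym (cantor-digit q r r<3) ⟩
  cantor (r + q * 3)                   ∎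
  where
  open ≡-Reasoning
  T = 3 ^ K
  regroup : ∀ r q T → 3 * T + 3 * T + (r + q * 3) ≡ r + (T + T + q) * 3
  regroup = solve-∀

factor-suc : ∀ i n → factor i (suc n) ≡ cantor i ∷ factor (suc i) n
factor-suc i n = cong₂ _∷_ (cong cantor (+-identityʳ i)) (begin
  map letter (applyUpTo suc n)    ≡⟨ map-applyUpTo suc letter n ⟩
  applyUpTo (letter ∘ suc) n      ≡⟨ sym (map-applyUpTo id (letter ∘ suc) n) ⟩
  map (letter ∘ suc) (upTo n)     ≡⟨ map-cong (λ k → cong cantor (+-suc i k)) (upTo n) ⟩
  factor (suc i) n                ∎)
  where
  open ≡-Reasoning
  letter : ℕ → ℕ
  letter k = cantor (i + k)

length-factor : ∀ i n → length (factor i n) ≡ n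
length-factor i n = trans (length-map _ (upTo n)) (length-applyUpTo id n)

factor-isFactor : ∀ i n → IsFactor (factor i n)
factor-isFactor i n = i , cong (factor i) (length-factor i n)

factor-++ : ∀ i m n → factor i (m + n) ≡ factor i m ++ factor (i + m) n
factor-++ i zero    n = cong (λ x → factor x n) (sym (+-identityʳ i))
factor-++ i (suc m) n = begin
  factor i (suc m + n)                                   ≡⟨ factor-suc i (m + n) ⟩
  cantor i ∷ factor (suc i) (m + n)                      ≡⟨ cong (cantor i ∷_) (factor-++ (suc i) m n) ⟩
  cantor i ∷ (factor (suc i) m ++ factor (suc i + m) n)  ≡⟨ cong (λ x → cantor i ∷ (factor (suc i) m ++ factor x n)) (sym (+-suc i m)) ⟩
  cantor i ∷ factor (suc i) m ++ factor (i + suc m) n    ≡⟨ cong (_++ factor (i + suc m) n) (sym (factor-suc i m)) ⟩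
  factor i (suc m) ++ factor (i + suc m) n               ∎
  where open ≡-Reasoning

factor-cong : ∀ i j n → (∀ k → k < n → cantor (i + k) ≡ cantor (j + k)) → factor i n ≡ factor j n
factor-cong i j zero    _  = refl
factor-cong i j (suc n) eq = begin
  factor i (suc n)             ≡⟨ factor-suc i n ⟩
  cantor i ∷ factor (suc i) n  ≡⟨ cong₂ _∷_ first (factor-cong (suc i) (suc j) n rest) ⟩
  cantor j ∷ factor (suc j) n  ≡⟨ sym (factor-suc j n) ⟩
  factor j (suc n)             ∎
  where
  open ≡-Reasoning
  first : cantor i ≡ cantor j
  first = trans (cong cantor (sym (+-identityʳ i))) (trans (eq 0 (s≤s z≤n)) (cong cantor (+-identityʳ j)))
  rest : ∀ k → k < n → cantor (suc i + k) ≡ cantor (suc j + k)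
  rest k k<n = trans (cong cantor (sym (+-suc i k))) (trans (eq (suc k) (s≤s k<n)) (cong cantor (+-suc j k)))

factor-zero : ∀ i n → (∀ k → k < n → cantor (i + k) ≡ 0) → factor i n ≡ replicate n 0
factor-zero i zero    _  = refl
factor-zero i (suc n) eq = trans (factor-suc i n) (cong₂ _∷_ first (factor-zero (suc i) n rest))
  where
  first : cantor i ≡ 0
  first = trans (cong cantor (sym (+-identityʳ i))) (eq 0 (s≤s z≤n))
  rest : ∀ k → k < n → cantor (suc i + k) ≡ 0
  rest k k<n = trans (cong cantor (sym (+-suc i k))) (eq (suc k) (s≤s k<n))

count1-++ : ∀ xs ys → count1 (xs ++ ys) ≡ count1 xs + count1 ys
count1-++ xs ys = trans (cong length (filter-++ (_≟ 1) xs ys)) (length-++ (filter (_≟ 1) xs))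

count1-zeros : ∀ n → count1 (replicate n 0) ≡ 0
count1-zeros zero    = refl
count1-zeros (suc n) = count1-zeros n

count1-bit : ∀ {x} → IsBit x → count1 (x ∷ []) ≡ x
count1-bit (inj₁ refl) = refl
count1-bit (inj₂ refl) = refl

S : ℕ → ℕ
S n = count1 (factor 0 n)

S-split : ∀ i n → S (i + n) ≡ S i + count1 (factor i n)
S-split i n = trans (cong count1 (factor-++ 0 i n)) (count1-++ (factor 0 i) (factor i n))

S-suc : ∀ n → S (suc n) ≡ S n + cantor n
S-suc n = begin
  S (suc n)                      ≡⟨ cong S (+-comm 1 n) ⟩
  S (n + 1)                      ≡⟨ S-split n 1 ⟩
  S n + count1 (factor n 1)      ≡⟨ cong (λ w → S n + count1 w) (factor-suc n 0) ⟩
  S n + count1 (cantor n ∷ [])   ≡⟨ cong (S n +_) (count1-bit (cantor-bit n)) ⟩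
  S n + cantor n                 ∎
  where open ≡-Reasoning

S-mono : ∀ {a b} → a ≤ b → S a ≤ S b
S-mono {a} a≤b with m≤n⇒∃[o]m+o≡n a≤b
... | d , refl = subst (S a ≤_) (sym (S-split a d)) (m≤m+n (S a) _)

half-≤ : ∀ {a b} → a + a ≤ b + b → a ≤ b
half-≤ {a} {b} le with a ≤? b
... | yes a≤b = a≤b
... | no  a≰b = ⊥-elim (<⇒≱ (+-mono-< (≰⇒> a≰b) (≰⇒> a≰b)) le)

thrice : ∀ x → 3 * x ≡ x + x + x
thrice = solve-∀

module PowerOfThree (K : ℕ) where

  T : ℕ
  T = 3 ^ K

  middle-block : ∀ i n → T ≤ i → i + n ≤ T + T → factor i n ≡ replicate n 0
  middle-block i n T≤i i+n≤2T with m≤n⇒∃[o]m+o≡n T≤i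
  ... | d , refl = factor-zero (T + d) n λ k k<n →
    trans (cong cantor (+-assoc T d k)) (middle-zero K (d + k) (d+k<T k<n))
    where
    d+k<T : ∀ {k} → k < n → d + k < T
    d+k<T k<n = <-≤-trans (+-monoʳ-< d k<n) (+-cancelˡ-≤ T (d + n) T (subst (_≤ T + T) (+-assoc T d n) i+n≤2T))

  last-block : ∀ n → n ≤ T → factor (T + T) n ≡ factor 0 n
  last-block n n≤T = factor-cong (T + T) 0 n λ k k<n → last-copy K k (<-≤-trans k<n n≤T)

  S-plateau : ∀ {x} → T ≤ x → x ≤ T + T → S x ≡ S T
  S-plateau {x} T≤x x≤2T with m≤n⇒∃[o]m+o≡n T≤x
  ... | y , refl = begin
    S (T + y)                     ≡⟨ S-split T y ⟩
    S T + count1 (factor T y)     ≡⟨ cong (λ w → S T + count1 w) (middle-block T y ≤-refl x≤2T) ⟩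
    S T + count1 (replicate y 0)  ≡⟨ cong (S T +_) (count1-zeros y) ⟩
    S T + 0                       ≡⟨ +-identityʳ (S T) ⟩
    S T                           ∎
    where open ≡-Reasoning

  S-copy : ∀ {x} → T + T ≤ x → x ≤ T + T + T → S x ≡ S T + S (x ∸ (T + T))
  S-copy {x} 2T≤x x≤3T with m≤n⇒∃[o]m+o≡n 2T≤x
  ... | y , refl = begin
    S (T + T + y)                         ≡⟨ S-split (T + T) y ⟩
    S (T + T) + count1 (factor (T + T) y) ≡⟨ cong₂ _+_ (S-plateau (m≤m+n T T) ≤-refl) (cong count1 (last-block y y≤T)) ⟩
    S T + S y                             ≡⟨ cong (λ z → S T + S z) (sym (m+n∸m≡n (T + T) y)) ⟩
    S T + S (T + T + y ∸ (T + T))         ∎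
    where
    open ≡-Reasoning
    y≤T : y ≤ T
    y≤T = +-cancelˡ-≤ (T + T) y T x≤3T

  subadditive-step : (∀ a b → a + b ≤ T → S (a + b) ≤ S a + S b) →
                     ∀ a b → a ≤ b → a + b ≤ T + T + T → S (a + b) ≤ S a + S b
  subadditive-step sub a b a≤b ab≤3T = by-cases (a + b ≤? T) (a + b ≤? T + T) (T + T ≤? b)
    where
    open ≤-Reasoning
    a+a≤a+b : a + a ≤ a + b
    a+a≤a+b = +-monoʳ-≤ a a≤b

    -- a + b ∈ [T, 2T]: then a ≤ T, and S (a + b) = S T ≤ S a + S (T ∸ a).
    middle : T ≤ a + b → a + b ≤ T + T → S (a + b) ≤ S a + S b
    middle T≤ab ab≤2T = begin
      S (a + b)        ≡⟨ S-plateau T≤ab ab≤2T ⟩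
      S T              ≡⟨ cong S (sym (m+[n∸m]≡n a≤T)) ⟩
      S (a + (T ∸ a))  ≤⟨ sub a (T ∸ a) (≤-reflexive (m+[n∸m]≡n a≤T)) ⟩
      S a + S (T ∸ a)  ≤⟨ +-monoʳ-≤ (S a) (S-mono (m≤n+o⇒m∸n≤o T a T≤ab)) ⟩
      S a + S b        ∎
      where
      a≤T : a ≤ T
      a≤T = half-≤ (≤-trans a+a≤a+b ab≤2T)

    -- b ≥ 2T: both a + b and b lie in the last block.
    last-long : T + T ≤ b → S (a + b) ≤ S a + S b
    last-long 2T≤b = begin
      S (a + b)                       ≡⟨ S-copy (≤-trans 2T≤b (m≤n+m b a)) ab≤3T ⟩
      S T + S (a + b ∸ (T + T))       ≡⟨ cong (λ z → S T + S z) (+-∸-assoc a 2T≤b) ⟩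
      S T + S (a + (b ∸ (T + T)))     ≤⟨ +-monoʳ-≤ (S T) (sub a (b ∸ (T + T)) fits) ⟩
      S T + (S a + S (b ∸ (T + T)))   ≡⟨ x+[y+z]≡y+[x+z] (S T) (S a) _ ⟩
      S a + (S T + S (b ∸ (T + T)))   ≡⟨ cong (S a +_) (sym (S-copy 2T≤b (≤-trans (m≤n+m b a) ab≤3T))) ⟩
      S a + S b                       ∎
      where
      fits : a + (b ∸ (T + T)) ≤ T
      fits = subst (_≤ T) (+-∸-assoc a 2T≤b) (m≤n+o⇒m∸n≤o (a + b) (T + T) ab≤3T)
      x+[y+z]≡y+[x+z] : ∀ x y z → x + (y + z) ≡ y + (x + z)
      x+[y+z]≡y+[x+z] = solve-∀

    -- b < 2T < a + b: b lies in the middle block and a + b - 2T ≤ a.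
    last-short : T + T ≤ a + b → b ≤ T + T → S (a + b) ≤ S a + S b
    last-short 2T≤ab b≤2T = begin
      S (a + b)                  ≡⟨ S-copy 2T≤ab ab≤3T ⟩
      S T + S (a + b ∸ (T + T))  ≤⟨ +-monoʳ-≤ (S T) (S-mono (m≤n+o⇒m∸n≤o (a + b) (T + T) ab≤2T+a)) ⟩
      S T + S a                  ≡⟨ cong (_+ S a) (sym (S-plateau T≤b b≤2T)) ⟩
      S b + S a                  ≡⟨ +-comm (S b) (S a) ⟩
      S a + S b                  ∎
      where
      T≤b : T ≤ b
      T≤b = half-≤ (≤-trans 2T≤ab (+-monoˡ-≤ b a≤b))
      ab≤2T+a : a + b ≤ T + T + a
      ab≤2T+a = subst (a + b ≤_) (+-comm a (T + T)) (+-monoʳ-≤ a b≤2T)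

    by-cases : Dec (a + b ≤ T) → Dec (a + b ≤ T + T) → Dec (T + T ≤ b) → S (a + b) ≤ S a + S b
    by-cases (yes ab≤T) _           _          = sub a b ab≤T
    by-cases (no  ab≰T) (yes ab≤2T) _          = middle (<⇒≤ (≰⇒> ab≰T)) ab≤2T
    by-cases (no  _)    (no  _)     (yes 2T≤b) = last-long 2T≤b
    by-cases (no  _)    (no  ab≰2T) (no  2T≰b) = last-short (<⇒≤ (≰⇒> ab≰2T)) (<⇒≤ (≰⇒> 2T≰b))

  subadditive-triple : (∀ a b → a + b ≤ T → S (a + b) ≤ S a + S b) →
                       ∀ a b → a + b ≤ 3 * T → S (a + b) ≤ S a + S b
  subadditive-triple sub a b ab≤3T with a ≤? b
  ... | yes a≤b = subadditive-step sub a b a≤b (subst (a + b ≤_) (thrice T) ab≤3T)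
  ... | no  a≰b = subst₂ _≤_ (cong S (+-comm b a)) (+-comm (S b) (S a))
                    (subadditive-step sub b a (<⇒≤ (≰⇒> a≰b)) (subst₂ _≤_ (+-comm a b) (thrice T) ab≤3T))

  zeros-then-prefix : ∀ d z y → d + z ≡ T → y ≤ T → factor (T + d) (z + y) ≡ replicate z 0 ++ factor 0 y
  zeros-then-prefix d z y d+z≡T y≤T = begin
    factor (T + d) (z + y)                    ≡⟨ factor-++ (T + d) z y ⟩
    factor (T + d) z ++ factor (T + d + z) y  ≡⟨ cong₂ _++_ (middle-block (T + d) z (m≤m+n T d) (≤-reflexive end)) (cong (λ i → factor i y) end) ⟩
    replicate z 0 ++ factor (T + T) y         ≡⟨ cong (replicate z 0 ++_) (last-block y y≤T) ⟩
    replicate z 0 ++ factor 0 y               ∎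
    where
    open ≡-Reasoning
    end : T + d + z ≡ T + T
    end = trans (+-assoc T d z) (cong (T +_) d+z≡T)

n<3^n : ∀ n → n < 3 ^ n
n<3^n zero    = s≤s z≤n
n<3^n (suc n) = begin-strict
  suc n                  ≤⟨ n<3^n n ⟩
  3 ^ n                  <⟨ m<m+n (3 ^ n) (<-≤-trans (s≤s z≤n) (n<3^n n)) ⟩
  3 ^ n + 3 ^ n          ≤⟨ +-monoʳ-≤ (3 ^ n) (m≤m+n (3 ^ n) (3 ^ n + 0)) ⟩
  3 ^ suc n              ∎
  where open ≤-Reasoning

subadditive-below : ∀ K a b → a + b ≤ 3 ^ K → S (a + b) ≤ S a + S b
subadditive-below zero    zero          b       _         = ≤-refl
subadditive-below zero    (suc zero)    zero    _         = ≤-refl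
subadditive-below zero    (suc zero)    (suc b) (s≤s ())
subadditive-below zero    (suc (suc a)) b       (s≤s ())
subadditive-below (suc K) = PowerOfThree.subadditive-triple K (subadditive-below K)

subadditive : ∀ a b → S (a + b) ≤ S a + S b
subadditive a b = subadditive-below (a + b) a b (<⇒≤ (n<3^n (a + b)))

window-≤-prefix : ∀ i n → count1 (factor i n) ≤ S n
window-≤-prefix i n = +-cancelˡ-≤ (S i) _ _ (subst (_≤ S i + S n) (S-split i n) (subadditive i n))

Mc-≤-prefix : ∀ ℓ M → IsMc ℓ M → M ≤ S ℓ
Mc-≤-prefix ℓ M ((i , window≡M) , _) = subst (_≤ S ℓ) window≡M (window-≤-prefix i ℓ)

unit-steps-hit : (g : ℕ → ℕ) → (∀ n → g (suc n) ≤ suc (g n)) →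
                 ∀ ℓ h → g 0 < h → h ≤ g ℓ → ∃[ p ] (p < ℓ × suc (g p) ≡ h × g (suc p) ≡ h)
unit-steps-hit g steps zero    h g0<h h≤g0 = ⊥-elim (<⇒≱ g0<h h≤g0)
unit-steps-hit g steps (suc ℓ) h g0<h h≤gsℓ with h ≤? g ℓ
... | yes h≤gℓ with unit-steps-hit g steps ℓ h g0<h h≤gℓ
...   | p , p<ℓ , before , after = p , m<n⇒m<1+n p<ℓ , before , after
unit-steps-hit g steps (suc ℓ) h g0<h h≤gsℓ | no h≰gℓ =
  ℓ , ≤-refl , ≤-antisym (≰⇒> h≰gℓ) h≤1+gℓ , ≤-antisym (≤-trans (steps ℓ) (≰⇒> h≰gℓ)) h≤gsℓ
  where
  h≤1+gℓ : h ≤ suc (g ℓ)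
  h≤1+gℓ = ≤-trans h≤gsℓ (steps ℓ)

bit-≤1 : ∀ {x} → IsBit x → x ≤ 1
bit-≤1 (inj₁ refl) = z≤n
bit-≤1 (inj₂ refl) = ≤-refl

S-steps : ∀ n → S (suc n) ≤ suc (S n)
S-steps n = begin
  S (suc n)       ≡⟨ S-suc n ⟩
  S n + cantor n  ≤⟨ +-monoʳ-≤ (S n) (bit-≤1 (cantor-bit n)) ⟩
  S n + 1         ≡⟨ +-comm (S n) 1 ⟩
  suc (S n)       ∎
  where open ≤-Reasoning

S-increment : ∀ p → S (suc p) ≡ suc (S p) → cantor p ≡ 1
S-increment p eq = +-cancelˡ-≡ (S p) (cantor p) 1 (trans (sym (S-suc p)) (trans eq (+-comm 1 (S p))))

-- Every 1 ≤ h ≤ S ℓ is S m + α for a position m ≤ ℓ carrying the letter α: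
-- take the h-th one (α = 1) or the letter after it, a zero by no-11 (α = 0).
choose-last-letter : ∀ α → IsBit α → ∀ ℓ h → 1 ≤ h → h ≤ S ℓ →
                     ∃[ m ] (m ≤ ℓ × cantor m ≡ α × S m + α ≡ h)
choose-last-letter α α-bit ℓ h 1≤h h≤Sℓ with unit-steps-hit S S-steps ℓ h 1≤h h≤Sℓ
... | p , p<ℓ , before , after = last-letter α-bit
  where
  cp≡1 : cantor p ≡ 1
  cp≡1 = S-increment p (trans after (sym before))
  last-letter : ∀ {α} → IsBit α → ∃[ m ] (m ≤ ℓ × cantor m ≡ α × S m + α ≡ h)
  last-letter (inj₁ refl) = suc p , p<ℓ , no-11 p cp≡1 , trans (+-identityʳ (S (suc p))) after
  last-letter (inj₂ refl) = p , <⇒≤ p<ℓ , cp≡1 , trans (+-comm (S p) 1) before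

-- Given a position m with c_m = α and S m + α = h, and j = ℓ - m, take
-- T = 3^(ℓ+2) > ℓ + 2: the window 0^{j+2} c₀⋯c_m ending at 2T + m is
-- W_h = 0 0 U_h α with U_h = 0^j c₀⋯c_{m-1}, itself the window 0^j c₀⋯c_{m-1}.
window-realizing : ∀ α ℓ h m j → m + j ≡ ℓ → cantor m ≡ α → S m + α ≡ h →
  ∃[ W ] ∃[ U ] (IsFactor W × length W ≡ ℓ + 3 × count1 W ≡ h ×
    W ≡ 0 ∷ 0 ∷ (U ++ (α ∷ [])) × IsFactor U × length U ≡ ℓ)
window-realizing α ℓ h m j m+j≡ℓ cm≡α Sm+α≡h =
  W , U , subst IsFactor W-window (factor-isFactor (T + d) _) , length-W , count1-W ,
  refl , subst IsFactor U-window (factor-isFactor (T + (d + 2)) _) , length-U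
  where
  open PowerOfThree (ℓ + 2) using (T; zeros-then-prefix)
  open ≡-Reasoning

  U W : List ℕ
  U = replicate j 0 ++ factor 0 m
  W = 0 ∷ 0 ∷ (U ++ (α ∷ []))

  ℓ+2≤T : ℓ + 2 ≤ T
  ℓ+2≤T = <⇒≤ (n<3^n (ℓ + 2))
  m≤ℓ : m ≤ ℓ
  m≤ℓ = subst (m ≤_) m+j≡ℓ (m≤m+n m j)
  2+j≤T : 2 + j ≤ T
  2+j≤T = ≤-trans (subst (2 + j ≤_) (+-comm 2 ℓ) (+-monoʳ-≤ 2 (subst (j ≤_) m+j≡ℓ (m≤n+m j m)))) ℓ+2≤T
  m+1≤T : m + 1 ≤ T
  m+1≤T = ≤-trans (+-mono-≤ m≤ℓ (s≤s z≤n)) ℓ+2≤T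

  d : ℕ
  d = T ∸ (2 + j)
  d+[2+j]≡T : d + (2 + j) ≡ T
  d+[2+j]≡T = m∸n+n≡m 2+j≤T

  W-window : factor (T + d) ((2 + j) + (m + 1)) ≡ W
  W-window = begin
    factor (T + d) ((2 + j) + (m + 1))                    ≡⟨ zeros-then-prefix d (2 + j) (m + 1) d+[2+j]≡T m+1≤T ⟩
    0 ∷ 0 ∷ (replicate j 0 ++ factor 0 (m + 1))           ≡⟨ cong (λ w → 0 ∷ 0 ∷ (replicate j 0 ++ w)) (factor-++ 0 m 1) ⟩
    0 ∷ 0 ∷ (replicate j 0 ++ (factor 0 m ++ factor m 1)) ≡⟨ cong (λ w → 0 ∷ 0 ∷ (replicate j 0 ++ (factor 0 m ++ w))) (trans (factor-suc m 0) (cong (_∷ []) cm≡α)) ⟩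
    0 ∷ 0 ∷ (replicate j 0 ++ (factor 0 m ++ (α ∷ [])))   ≡⟨ cong (λ w → 0 ∷ 0 ∷ w) (sym (++-assoc (replicate j 0) (factor 0 m) (α ∷ []))) ⟩
    W                                                     ∎

  U-window : factor (T + (d + 2)) (j + m) ≡ U
  U-window = zeros-then-prefix (d + 2) j m (trans (+-assoc d 2 j) d+[2+j]≡T) (≤-trans (m≤m+n m 1) m+1≤T)

  length-W : length W ≡ ℓ + 3
  length-W = begin
    length W                                     ≡⟨ cong length (sym W-window) ⟩
    length (factor (T + d) ((2 + j) + (m + 1)))  ≡⟨ length-factor (T + d) _ ⟩
    (2 + j) + (m + 1)                            ≡⟨ regroup j m ⟩
    m + j + 3                                    ≡⟨ cong (_+ 3) m+j≡ℓ ⟩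
    ℓ + 3                                        ∎
    where
    regroup : ∀ j m → (2 + j) + (m + 1) ≡ m + j + 3
    regroup = solve-∀

  length-U : length U ≡ ℓ
  length-U = trans (cong length (sym U-window)) (trans (length-factor (T + (d + 2)) (j + m)) (trans (+-comm j m) m+j≡ℓ))

  count1-W : count1 W ≡ h
  count1-W = begin
    count1 W                          ≡⟨ count1-++ U (α ∷ []) ⟩
    count1 U + count1 (α ∷ [])        ≡⟨ cong (count1 U +_) (count1-bit (subst IsBit cm≡α (cantor-bit m))) ⟩
    count1 U + α                      ≡⟨ cong (_+ α) (count1-++ (replicate j 0) (factor 0 m)) ⟩
    count1 (replicate j 0) + S m + α  ≡⟨ cong (λ z → z + S m + α) (count1-zeros j) ⟩
    S m + α                           ≡⟨ Sm+α≡h ⟩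
    h                                 ∎

lemma4p5 : (α : ℕ) → (α ≡ 0 ⊎ α ≡ 1) → (ℓ : ℕ) → 1 ≤ ℓ → (M : ℕ) → IsMc ℓ M →
    (h : ℕ) → 1 ≤ h → h ≤ M →
    ∃[ W ] ∃[ U ] (IsFactor W × length W ≡ ℓ + 3 × count1 W ≡ h ×
      W ≡ 0 ∷ 0 ∷ (U ++ (α ∷ [])) × IsFactor U × length U ≡ ℓ)
lemma4p5 α α-bit ℓ _ M isMc h 1≤h h≤M
  with choose-last-letter α α-bit ℓ h 1≤h (≤-trans h≤M (Mc-≤-prefix ℓ M isMc))
... | m , m≤ℓ , cm≡α , Sm+α≡h = window-realizing α ℓ h m (ℓ ∸ m) (m+[n∸m]≡n m≤ℓ) cm≡α Sm+α≡h
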